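{- Let $p$ be a prime, $m\ge 1$, $V=GF(p)^{2m}$, and let $\mathcal{D}$ be a non-trivial $2$-$(p^{2m},p^{m},\lambda)$ design with point set $V$ and $\lambda\mid p^m$, admitting a flag-transitive automorphism group $G=T:G_0\le AGL(V)$ with $T$ the translation group of $V$. Then for every point $x$, every point $y\neq x$ and every block $B$ incident with $x$, one has $|y^{G_{x}}|=(p^{m}+1)\,|B\cap y^{G_{x}}|$. In particular, $p^{m}+1$ divides the length of every orbit of $G_{x}$ on points other than $\{x\}$.
   Context: A $2$-$(v,k,\lambda)$ design has $v$ points and $k$-subsets (blocks), every two distinct points lying in exactly $\lambda$ blocks; non-trivial means $2<k<v$. Flag-transitive: transitive on pairs $(x,B)$ with $x\in B$. $G_x$ is the stabilizer of the point $x$ and $y^{G_x}$ the $G_x$-orbit of $y$; $G_0=G\cap GL(V)$. -}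

module Defs where

open import Data.Nat using (ℕ; _+_; _*_; NonZero)
open import Data.Nat.DivMod using (_mod_)
open import Data.Fin using (Fin; toℕ)
open import Data.Vec using (Vec; map; zipWith; sum)
open import Data.Bool using (Bool; true)
open import Data.Product using (Σ; ∃; _×_; _,_)
open import Relation.Binary.PropositionalEquality using (_≡_)
open import Function.Bundles using (_⇔_; _↔_)
open import Relation.Nullary using (¬_)
open import Data.Irrelevant using (Irrelevant)

-- The vector space V = GF(p)^n (GF(p) realised as Fin p, arithmetic mod p)

Vect : ℕ → ℕ → Set
Vect p n = Vec (Fin p) n

-- n × n matrices over GF(p), as a vector of rows
Mat : ℕ → ℕ → Set
Mat p n = Vec (Vec (Fin p) n) n

vadd : ∀ p {n} .{{_ : NonZero p}} → Vect p n → Vect p n → Vect p n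
vadd p = zipWith (λ a b → (toℕ a + toℕ b) mod p)

dot : ∀ p {n} .{{_ : NonZero p}} → Vect p n → Vect p n → Fin p
dot p r x = sum (zipWith (λ a b → toℕ a * toℕ b) r x) mod p

mulMV : ∀ p {n} .{{_ : NonZero p}} → Mat p n → Vect p n → Vect p n
mulMV p A x = map (λ r → dot p r x) A

IsInvertible : ∀ p {n} .{{_ : NonZero p}} → Mat p n → Set
IsInvertible p {n} A = Σ (Mat p n) λ A' →
  (∀ x → mulMV p A' (mulMV p A x) ≡ x) × (∀ x → mulMV p A (mulMV p A' x) ≡ x)

record AGL (p n : ℕ) .{{_ : NonZero p}} : Set where
  constructor affine
  field
    lin   : Mat p n
    trans : Vect p n
    inv   : IsInvertible p lin

act : ∀ {p n} .{{_ : NonZero p}} → AGL p n → Vect p n → Vect p n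
act {p} g x = vadd p (mulMV p (AGL.lin g) x) (AGL.trans g)

_≗V_ : ∀ {p n} → (Vect p n → Vect p n) → (Vect p n → Vect p n) → Set
f ≗V h = ∀ x → f x ≡ h x

-- G (a predicate on AGL(V)) is a subgroup of AGL(V)
-- (elements compared through their action on V)
record IsSubgroup {p n : ℕ} .{{_ : NonZero p}} (G : AGL p n → Set) : Set where
  field
    has-id  : Σ (AGL p n) λ e → G e × (act e ≗V (λ x → x))
    has-mul : ∀ g h → G g → G h →
              Σ (AGL p n) λ k → G k × (act k ≗V (λ x → act g (act h x)))
    has-inv : ∀ g → G g →
              Σ (AGL p n) λ h → G h × ((λ x → act h (act g x)) ≗V (λ x → x))

ContainsTranslations : ∀ {p n} .{{_ : NonZero p}} → (AGL p n → Set) → Set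
ContainsTranslations {p} {n} G =
  ∀ (t : Vect p n) → Σ (AGL p n) λ g → G g × (act g ≗V (λ x → vadd p x t))

HasSize : Set → ℕ → Set
HasSize A k = A ↔ Fin k

-- Designs with point set V and blocks B i ⊆ V (i : Fin b), subsets as
-- Bool-valued predicates; the blocks are pairwise distinct as subsets.

IsDesign : ∀ p n (k lam : ℕ) {b : ℕ} → (Fin b → Vect p n → Bool) → Set
IsDesign p n k lam {b} B =
  (∀ i j → (∀ z → B i z ≡ B j z) → i ≡ j) ×
  (∀ i → HasSize (Σ (Vect p n) λ z → B i z ≡ true) k) ×
  (∀ x y → ¬ (x ≡ y) → HasSize (Σ (Fin b) λ i → B i x ≡ true × B i y ≡ true) lam)

ImageIs : ∀ {p n} .{{_ : NonZero p}} → AGL p n →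
          (Vect p n → Bool) → (Vect p n → Bool) → Set
ImageIs {p} {n} g B B' =
  ∀ z → (B' z ≡ true) ⇔ (Σ (Vect p n) λ w → B w ≡ true × act g w ≡ z)

IsAutGroup : ∀ {p n} .{{_ : NonZero p}} {b : ℕ} →
             (AGL p n → Set) → (Fin b → Vect p n → Bool) → Set
IsAutGroup {p} {n} {b} G B =
  ∀ g → G g → ∀ i → Σ (Fin b) λ j → ImageIs g (B i) (B j)

FlagTransitive : ∀ {p n} .{{_ : NonZero p}} {b : ℕ} →
                 (AGL p n → Set) → (Fin b → Vect p n → Bool) → Set
FlagTransitive {p} {n} G B =
  ∀ x i x' i' → B i x ≡ true → B i' x' ≡ true →
  Σ (AGL p n) λ g → G g × act g x ≡ x' × ImageIs g (B i) (B i')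

InOrbit : ∀ {p n} .{{_ : NonZero p}} → (AGL p n → Set) →
          Vect p n → Vect p n → Vect p n → Set
InOrbit {p} {n} G x y z =
  Σ (AGL p n) λ g → G g × act g x ≡ x × act g y ≡ z

-- the set y^{G_x} (membership proof irrelevant, so this is a set of points)
Orbit : ∀ {p n} .{{_ : NonZero p}} → (AGL p n → Set) →
        Vect p n → Vect p n → Set
Orbit {p} {n} G x y = Σ (Vect p n) λ z → Irrelevant (InOrbit G x y z)

BlockOrbit : ∀ {p n} .{{_ : NonZero p}} → (AGL p n → Set) →
             (Vect p n → Bool) → Vect p n → Vect p n → Set
BlockOrbit {p} {n} G Bl x y =
  Σ (Vect p n) λ z → Bl z ≡ true × Irrelevant (InOrbit G x y z)

-- Count the flags (z , B) with x ∈ B in two ways.  Taking z ≠ x gives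
-- r (K − 1) = (v − 1) λ for the number r of blocks through x, where K is the block
-- size; with v = K² this forces r = (K + 1) λ.  Taking z in the orbit O = y^{G_x}
-- gives |O| λ = r |B ∩ O|, where |B ∩ O| does not depend on the block B through x
-- because G_x is transitive on those blocks and preserves O.  Cancelling λ ≠ 0
-- yields |O| = (K + 1) |B ∩ O|.
module Submission where

open import Defs
open import Data.Nat using (ℕ; zero; suc; _+_; _*_; _^_; _≤_; _<_; NonZero; ≢-nonZero⁻¹; s≤s; z≤n)
open import Data.Nat.Properties
  using (*-comm; *-assoc; *-cancelˡ-≡; *-cancelʳ-≡; +-identityʳ; ^-distribˡ-+-*; m^n≢0; <⇒≤)
open import Data.Nat.Divisibility using (_∣_; divides; 0∣⇒≡0)
open import Data.Nat.Primality using (Prime)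
open import Data.Nat.Tactic.RingSolver using (solve-∀)
open import Data.Fin using (Fin; zero; suc; punchIn; punchOut)
open import Data.Fin.Properties
  using (+↔⊎; *↔×; punchInᵢ≢i; punchOut-cong; punchIn-punchOut; punchOut-punchIn)
open import Data.Fin.Permutation using (↔⇒≡)
open import Data.Vec using (Vec; []; _∷_)
open import Data.Bool using (Bool; true; false)
open import Data.Product using (Σ; ∃; _×_; _,_; proj₁; proj₂)
open import Data.Product.Function.Dependent.Propositional using (Σ-↔)
open import Data.Sum using (_⊎_; inj₁; inj₂)
open import Data.Sum.Function.Propositional using (_⊎-↔_)
open import Data.Empty using (⊥-elim; ⊥-elim-irr)
open import Data.Irrelevant using (Irrelevant; [_])
import Data.Irrelevant as Irrelevant
open import Axiom.UniquenessOfIdentityProofs.WithK using (uip)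
open import Relation.Binary.PropositionalEquality
open import Relation.Nullary using (¬_)
open import Function.Bundles using (_↔_; mk↔ₛ′; Inverse; Injection; Equivalence)
open import Function.Properties.Inverse using (↔-refl; ↔-sym; ↔-trans; ↔⇒↣)

HasSize-unique : ∀ {A : Set} {a c} → HasSize A a → HasSize A c → a ≡ c
HasSize-unique e f = ↔⇒≡ (↔-trans (↔-sym e) f)

HasSize-⊎ : ∀ {A B : Set} {a c} → HasSize A a → HasSize B c → HasSize (A ⊎ B) (a + c)
HasSize-⊎ e f = ↔-trans (e ⊎-↔ f) (↔-sym +↔⊎)

HasSize-Σ : ∀ {A : Set} {P : A → Set} {a c} →
            HasSize A a → (∀ x → HasSize (P x) c) → HasSize (Σ A P) (a * c)
HasSize-Σ e f = ↔-trans (Σ-↔ e (f _)) (↔-sym *↔×)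

Vec-suc-↔ : ∀ {A : Set} n → Vec A (suc n) ↔ (A × Vec A n)
Vec-suc-↔ n = mk↔ₛ′ (λ { (x ∷ xs) → x , xs }) (λ { (x , xs) → x ∷ xs })
                    (λ _ → refl) (λ { (_ ∷ _) → refl })

HasSize-Vec : ∀ {A : Set} {a} → HasSize A a → ∀ n → HasSize (Vec A n) (a ^ n)
HasSize-Vec e zero    = mk↔ₛ′ (λ _ → zero) (λ _ → []) (λ { zero → refl }) (λ { [] → refl })
HasSize-Vec e (suc n) = ↔-trans (Vec-suc-↔ n) (HasSize-Σ e (λ _ → HasSize-Vec e n))

HasSize-≡true : (c : Bool) → ∃ λ s → HasSize (c ≡ true) s
HasSize-≡true false = 0 , mk↔ₛ′ (λ ()) (λ ()) (λ ()) (λ ())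
HasSize-≡true true  = 1 , mk↔ₛ′ (λ _ → zero) (λ _ → refl) (λ { zero → refl }) (λ { refl → refl })

Σ-Fin-suc-↔ : ∀ {n} (P : Fin (suc n) → Set) → Σ (Fin (suc n)) P ↔ (P zero ⊎ Σ (Fin n) (λ j → P (suc j)))
Σ-Fin-suc-↔ P = mk↔ₛ′ (λ { (zero , q) → inj₁ q ; (suc j , q) → inj₂ (j , q) })
                      (λ { (inj₁ q) → zero , q ; (inj₂ (j , q)) → suc j , q })
                      (λ { (inj₁ _) → refl ; (inj₂ _) → refl })
                      (λ { (zero , _) → refl ; (suc _ , _) → refl })

HasSize-filter : ∀ {n} (f : Fin n → Bool) → ∃ λ r → HasSize (Σ (Fin n) λ j → f j ≡ true) r
HasSize-filter {zero}  f = 0 , mk↔ₛ′ (λ ()) (λ ()) (λ ()) (λ ())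
HasSize-filter {suc n} f =
  let s , hd = HasSize-≡true (f zero)
      r , tl = HasSize-filter (λ j → f (suc j))
  in  s + r , ↔-trans (Σ-Fin-suc-↔ _) (HasSize-⊎ hd tl)

-- The proof of z ≢ x is irrelevant, so a point of A ∖ x is determined by its
-- underlying point of A.

_∖_ : (A : Set) → A → Set
A ∖ x = Σ A λ z → Irrelevant (z ≢ x)

∖-≡ : ∀ {A : Set} {x : A} {u v : A ∖ x} → proj₁ u ≡ proj₁ v → u ≡ v
∖-≡ refl = refl

HasSize-∖ : ∀ {A : Set} {c} → HasSize A (suc c) → (x : A) → HasSize (A ∖ x) c
HasSize-∖ {A} {c} e x = mk↔ₛ′ to′ from′ to′∘from′ from′∘to′
  where
  open Inverse e
  i = to x
  i≢to : ∀ {z} → .(z ≢ x) → i ≢ to z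
  i≢to z≢x i≡tz = ⊥-elim-irr (z≢x (sym (Injection.injective (↔⇒↣ e) i≡tz)))
  from-punchIn≢x : ∀ j → from (punchIn i j) ≢ x
  from-punchIn≢x j eq = punchInᵢ≢i i j (trans (sym (strictlyInverseˡ _)) (cong to eq))
  to′ : A ∖ x → Fin c
  to′ (z , [ z≢x ]) = punchOut (i≢to z≢x)
  from′ : Fin c → A ∖ x
  from′ j = from (punchIn i j) , [ from-punchIn≢x j ]
  to′∘from′ : ∀ j → to′ (from′ j) ≡ j
  to′∘from′ j = trans (punchOut-cong i (strictlyInverseˡ (punchIn i j))) (punchOut-punchIn i)
  from′∘to′ : ∀ u → from′ (to′ u) ≡ u
  from′∘to′ (z , [ z≢x ]) = ∖-≡ (trans (cong from (punchIn-punchOut (i≢to z≢x))) (strictlyInverseʳ z))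

∖-filter-↔ : ∀ {A : Set} (f : A → Bool) {x} (fx : f x ≡ true) →
             (Σ A λ z → f z ≡ true) ∖ (x , fx) ↔ (Σ A λ z → f z ≡ true × Irrelevant (z ≢ x))
∖-filter-↔ {A} f {x} fx = mk↔ₛ′
  (λ { ((z , fz) , [ ne ]) → z , fz , [ (λ z≡x → ne (lift z≡x fz)) ] })
  (λ { (z , fz , [ z≢x ]) → (z , fz) , [ (λ eq → z≢x (cong proj₁ eq)) ] })
  (λ _ → refl) (λ _ → refl)
  where
  lift : ∀ {z} → z ≡ x → (fz : f z ≡ true) → _≡_ {A = Σ A λ w → f w ≡ true} (z , fz) (x , fx)
  lift refl fz = cong (x ,_) (uip fz fx)

module _ {P : Set} {b : ℕ} (B : Fin b → P → Bool) where

  BlocksThrough : P → Set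
  BlocksThrough x = Σ (Fin b) λ j → B j x ≡ true

  BlocksThrough₂ : P → P → Set
  BlocksThrough₂ x z = Σ (Fin b) λ j → B j x ≡ true × B j z ≡ true

  flags-double-count : (O : P → Set) (x : P) {n lam r k : ℕ} →
    HasSize (Σ P O) n → (∀ z → O z → HasSize (BlocksThrough₂ x z) lam) →
    HasSize (BlocksThrough x) r →
    (∀ j → B j x ≡ true → HasSize (Σ P λ z → B j z ≡ true × O z) k) →
    n * lam ≡ r * k
  flags-double-count O x hO hλ hr hk =
    HasSize-unique (HasSize-Σ hO (λ u → hλ (proj₁ u) (proj₂ u)))
                   (↔-trans regroup (HasSize-Σ hr (λ v → hk (proj₁ v) (proj₂ v))))
    where
    regroup : Σ (Σ P O) (λ u → BlocksThrough₂ x (proj₁ u)) ↔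
              Σ (BlocksThrough x) (λ v → Σ P λ z → B (proj₁ v) z ≡ true × O z)
    regroup = mk↔ₛ′ (λ { ((z , oz) , j , bjx , bjz) → (j , bjx) , z , bjz , oz })
                    (λ { ((j , bjx) , z , bjz , oz) → (z , oz) , j , bjx , bjz })
                    (λ _ → refl) (λ _ → refl)

  replication-number : ∀ {K lam r} → 1 < K → HasSize P (K * K) →
    (∀ j → HasSize (Σ P λ z → B j z ≡ true) K) →
    (∀ y z → y ≢ z → HasSize (BlocksThrough₂ y z) lam) →
    (x : P) → HasSize (BlocksThrough x) r → r ≡ (K + 1) * lam
  replication-number {suc k} {lam} {r} (s≤s (s≤s z≤n)) hP hB h₂ x hr =
    *-cancelˡ-≡ r ((suc k + 1) * lam) k (sym (begin
      k * ((suc k + 1) * lam) ≡⟨ difference-of-squares k lam ⟩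
      (k + k * suc k) * lam   ≡⟨ [v-1]λ≡r[K-1] ⟩
      r * k                   ≡⟨ *-comm r k ⟩
      k * r                   ∎))
    where
    open ≡-Reasoning
    difference-of-squares : ∀ k lam → k * ((suc k + 1) * lam) ≡ (k + k * suc k) * lam
    difference-of-squares = solve-∀
    [v-1]λ≡r[K-1] : (k + k * suc k) * lam ≡ r * k
    [v-1]λ≡r[K-1] = flags-double-count (λ z → Irrelevant (z ≢ x)) x (HasSize-∖ hP x)
      (λ { z [ z≢x ] → h₂ x z (λ x≡z → ⊥-elim-irr (z≢x (sym x≡z))) }) hr
      (λ j bjx → ↔-trans (↔-sym (∖-filter-↔ (B j) bjx)) (HasSize-∖ (hB j) (x , bjx)))

module _ {p n : ℕ} .{{_ : NonZero p}} {G : AGL p n → Set} (G-sub : IsSubgroup G) where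
  open IsSubgroup G-sub

  act-injective : ∀ {g} → G g → ∀ u w → act g u ≡ act g w → u ≡ w
  act-injective {g} Gg u w eq with has-inv g Gg
  ... | h , _ , hg = trans (sym (hg u)) (trans (cong (act h) eq) (hg w))

  InOrbit-≢ : ∀ {x y z} → y ≢ x → InOrbit G x y z → z ≢ x
  InOrbit-≢ {x} {y} y≢x (g , Gg , gx , gy) z≡x = y≢x (act-injective Gg y x (trans gy (trans z≡x (sym gx))))

  InOrbit-stable : ∀ {x y z f} → G f → act f x ≡ x → InOrbit G x y z → InOrbit G x y (act f z)
  InOrbit-stable {x} {y} {f = f} Gf fx (h , Gh , hx , hy) with has-mul f h Gf Gh
  ... | q , Gq , q≗fh = q , Gq , trans (q≗fh x) (trans (cong (act f) hx) fx) , trans (q≗fh y) (cong (act f) hy)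

  BlockOrbit-≡ : ∀ {Bl x y} {u v : BlockOrbit G Bl x y} → proj₁ u ≡ proj₁ v → u ≡ v
  BlockOrbit-≡ {u = z , bz , _} {v = .z , bz′ , _} refl = cong (λ q → z , q , _) (uip bz bz′)

  BlockOrbit-↔ : ∀ {Bl Bl′ x y g} → G g → act g x ≡ x → ImageIs g Bl Bl′ →
                 BlockOrbit G Bl x y ↔ BlockOrbit G Bl′ x y
  BlockOrbit-↔ {Bl} {Bl′} {x} {y} {g} Gg gx img with has-inv g Gg
  ... | g′ , Gg′ , g′g = mk↔ₛ′ to from to∘from from∘to
    where
    g′x : act g′ x ≡ x
    g′x = trans (cong (act g′) (sym gx)) (g′g x)
    g′-in-Bl : ∀ z → Bl′ z ≡ true → Bl (act g′ z) ≡ true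
    g′-in-Bl z bz with Equivalence.to (img z) bz
    ... | w , bw , refl = subst (λ t → Bl t ≡ true) (sym (g′g w)) bw
    gg′ : ∀ z → Bl′ z ≡ true → act g (act g′ z) ≡ z
    gg′ z bz with Equivalence.to (img z) bz
    ... | w , _ , refl = cong (act g) (g′g w)
    to : BlockOrbit G Bl x y → BlockOrbit G Bl′ x y
    to (z , bz , o) = act g z , Equivalence.from (img (act g z)) (z , bz , refl) ,
                      Irrelevant.map (InOrbit-stable Gg gx) o
    from : BlockOrbit G Bl′ x y → BlockOrbit G Bl x y
    from (z , bz , o) = act g′ z , g′-in-Bl z bz , Irrelevant.map (InOrbit-stable Gg′ g′x) o
    to∘from : ∀ v → to (from v) ≡ v
    to∘from (z , bz , _) = BlockOrbit-≡ (gg′ z bz)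
    from∘to : ∀ u → from (to u) ≡ u
    from∘to (z , _ , _) = BlockOrbit-≡ (g′g z)

  FlagTransitive⇒BlockOrbit-↔ : ∀ {b} {B : Fin b → Vect p n → Bool} → FlagTransitive G B →
    ∀ {x y i j} → B i x ≡ true → B j x ≡ true → BlockOrbit G (B i) x y ↔ BlockOrbit G (B j) x y
  FlagTransitive⇒BlockOrbit-↔ ft {x} {i = i} {j} bix bjx with ft x i x j bix bjx
  ... | g , Gg , gx , img = BlockOrbit-↔ Gg gx img

∣-nonZero : ∀ {d m} → d ∣ m → .{{NonZero m}} → NonZero d
∣-nonZero {zero} {m} 0∣m = ⊥-elim (≢-nonZero⁻¹ m (0∣⇒≡0 0∣m))
∣-nonZero {suc _} _      = _

p^[2m]≡p^m*p^m : ∀ p m → p ^ (2 * m) ≡ p ^ m * p ^ m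
p^[2m]≡p^m*p^m p m = trans (^-distribˡ-+-* p m (m + 0)) (cong (λ e → p ^ m * p ^ e) (+-identityʳ m))

lemma2p1 : (p : ℕ) .{{_ : NonZero p}} → Prime p → (m : ℕ) → 1 ≤ m →
    (lam b : ℕ) (B : Fin b → Vect p (2 * m) → Bool) →
    IsDesign p (2 * m) (p ^ m) lam B →
    2 < p ^ m → p ^ m < p ^ (2 * m) →
    lam ∣ p ^ m →
    (G : AGL p (2 * m) → Set) →
    IsSubgroup G → ContainsTranslations G →
    IsAutGroup G B → FlagTransitive G B →
    ∀ x y → ¬ (y ≡ x) → ∀ i → B i x ≡ true →
    ∀ n k → HasSize (Orbit G x y) n → HasSize (BlockOrbit G (B i) x y) k →
    (n ≡ (p ^ m + 1) * k) × ((p ^ m + 1) ∣ n)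
lemma2p1 p _ m _ lam b B (_ , blockSize , pairSize) 2<K _ lam∣K G G-sub _ _ ft x y y≢x i bix n k hn hk =
  n≡[K+1]k , divides k (trans n≡[K+1]k (*-comm (K + 1) k))
  where
  open ≡-Reasoning
  K = p ^ m
  instance
    K≢0 = m^n≢0 p m
    lam≢0 = ∣-nonZero lam∣K
  r = proj₁ (HasSize-filter (λ j → B j x))
  hr = proj₂ (HasSize-filter (λ j → B j x))
  r≡[K+1]λ : r ≡ (K + 1) * lam
  r≡[K+1]λ = replication-number B (<⇒≤ 2<K)
    (subst (HasSize (Vect p (2 * m))) (p^[2m]≡p^m*p^m p m) (HasSize-Vec ↔-refl (2 * m)))
    blockSize pairSize x hr
  nλ≡rk : n * lam ≡ r * k
  nλ≡rk = flags-double-count B (λ z → Irrelevant (InOrbit G x y z)) x hn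
    (λ { z [ o ] → pairSize x z (λ x≡z → ⊥-elim-irr (InOrbit-≢ G-sub y≢x o (sym x≡z))) })
    hr (λ j bjx → ↔-trans (FlagTransitive⇒BlockOrbit-↔ G-sub ft bjx bix) hk)
  n≡[K+1]k : n ≡ (K + 1) * k
  n≡[K+1]k = *-cancelʳ-≡ n ((K + 1) * k) lam (begin
    n * lam               ≡⟨ nλ≡rk ⟩
    r * k                 ≡⟨ cong (_* k) r≡[K+1]λ ⟩
    (K + 1) * lam * k     ≡⟨ *-assoc (K + 1) lam k ⟩
    (K + 1) * (lam * k)   ≡⟨ cong ((K + 1) *_) (*-comm lam k) ⟩
    (K + 1) * (k * lam)   ≡⟨ *-assoc (K + 1) k lam ⟨
    (K + 1) * k * lam     ∎)
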